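{- For every agent $a\in\mathsf{Ag}$ and every formula $\phi$ of $\mathcal{L}^{\mathsf C}$, the formula $\mathsf{K}_a\phi\to\mathsf{K}_a\mathsf{K}_a\phi$ is valid.
   Context: Fix a countable set $\mathsf{Prop}$ of atomic propositions and a finite set $\mathsf{Ag}$ of agents. A concurrent game structure is a tuple $\mathcal{G}=(\mathsf{Ac},\mathsf{V},\mathsf{E},\ell,(\sim_a)_{a\in\mathsf{Ag}})$ where $\mathsf{Ac}$ is a finite set of actions, $\mathsf{V}$ is a finite set of positions, $\mathsf{E}:\mathsf{V}\times\mathsf{Ac}^{\mathsf{Ag}}\to\mathsf{V}$ is a transition function, $\ell:\mathsf{V}\to\mathcal{P}(\mathsf{Prop})$ is a valuation, and for each agent $a$, $\sim_a\subseteq(\mathsf{V}\times\mathsf{V})\cup(\mathsf{Ac}\times\mathsf{Ac})$ is an equivalence relation. A joint action is a function $\alpha:\mathsf{Ag}\to\mathsf{Ac}$; $\alpha\sim_a\beta$ iff $\alpha(b)\sim_a\beta(b)$ for all $b$. A history is a sequence $\rho=v_0\alpha_1v_1\ldots\alpha_nv_n$ of positions and joint actions with $\mathsf{E}(v_i,\alpha_{i+1})=v_{i+1}$ for all $i<n$; $\rho_{\le i}=v_0\alpha_1\ldots\alpha_iv_i$, $\mathsf{last}(\rho)=v_n$; $\mathsf{Hist}$ is the set of histories. $\rho\sim_a\rho'$ for histories iff they have the same number $n$ of joint actions, their $i$-th positions are $\sim_a$-related for all $i\le n$ and their $i$-th joint actions are $\sim_a$-related for all $1\le i\le n$. A strategy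 is a function $\mathsf{Hist}\to\mathsf{Ac}$; an assignment is a function $\chi$ from $\mathsf{Ag}$ to strategies. $\rho$ is consistent with $\chi$ for $X\subseteq\mathsf{Ag}$ if $\alpha_{i+1}(b)=\chi(b)(\rho_{\le i})$ for all $i<n$, $b\in X$. The one-step continuation is $\mathsf{X}^\chi_{\mathcal G}\rho=v_0\alpha_1\ldots\alpha_nv_n\alpha_{n+1}v_{n+1}$ with $\alpha_{n+1}(b)=\chi(b)(\rho)$ for all $b$ and $v_{n+1}=\mathsf{E}(v_n,\alpha_{n+1})$. $\mathsf{Ag}^*$ is the set of finite words over $\mathsf{Ag}$ with no two equal adjacent letters; $\mathsf{Ag}^{\ge n}$ those of length $\ge n$; $aw$ denotes $w$ prefixed by $a$. An information perspective is a set $\mathrm{I}\subseteq\mathsf{Ag}^{\ge2}$; $\mathrm{I}_a=\{b: ab\in\mathrm{I}\}\cup\{a\}$; $\mathrm{I}[a]=\{w\in\mathsf{Ag}^{\ge2}: aw\in\mathrm{I}\}\cup\{w\in\mathrm{I}: w=aw'\text{ for some }w'\in\mathsf{Ag}^*\}$. $\chi\sim^{\mathrm{I}}_a\chi'$ iff $\chi(b)=\chi'(b)$ for all $b\in\mathrm{I}_a$. A state is a triple $(\chi,\mathrm{I},\rho)$ (assignment, information perspective, history); it is $a$-consistent if $\rho$ is consistent with $\chi$ for $\mathrm{I}_a$. $(\chi,\mathrm{I},\rho)\trianglelefteq_a(\chi',\mathrm{I}',\rho')$ iff $\chi\sim^{\mathrm{I}}_a\chi'$, $\mathrm{I}[a]\subseteq\mathrm{I}'$,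 $\rho\sim_a\rho'$, and both states are $a$-consistent. For $G\subseteq\mathsf{Ag}$, $Z\trianglelefteq_GZ'$ iff $Z\trianglelefteq_aZ'$ for some $a\in G$, and $\trianglelefteq^*_G$ is the transitive closure of $\trianglelefteq_G$. Formulas of $\mathcal{L}^{\mathsf C}$: $\phi::=p\mid\bot\mid\phi\to\phi\mid\mathsf{K}_a\phi\mid\mathsf{C}_G\phi\mid\mathsf{X}\phi$ with $p\in\mathsf{Prop}$, $a\in\mathsf{Ag}$, $G\subseteq\mathsf{Ag}$ (other connectives defined as usual). Truth at $Z=(\chi,\mathrm{I},\rho)$: $\mathcal{G},Z\Vdash p$ iff $p\in\ell(\mathsf{last}(\rho))$; $\bot$ is never true; $\to$ is classical; $\mathcal{G},Z\Vdash\mathsf{K}_a\phi$ iff $\mathcal{G},Z'\Vdash\phi$ for all $Z'$ with $Z\trianglelefteq_aZ'$; $\mathcal{G},Z\Vdash\mathsf{C}_G\phi$ iff $\mathcal{G},Z'\Vdash\phi$ for all $Z'$ with $Z\trianglelefteq^*_GZ'$; $\mathcal{G},Z\Vdash\mathsf{X}\phi$ iff $\mathcal{G},(\chi,\mathrm{I},\mathsf{X}^\chi_{\mathcal G}\rho)\Vdash\phi$. A formula is valid if it is true at every state of every concurrent game structure. -}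

module Defs where

open import Level using (Level; 0ℓ; Lift) renaming (suc to lsuc)
open import Data.Nat using (ℕ; _≥_)
open import Data.Fin using (Fin)
open import Data.Fin.Subset using (Subset; _∈_)
open import Data.List using (List; []; _∷_; length)
open import Data.Product using (Σ; _×_; _,_; ∃)
open import Data.Sum using (_⊎_)
open import Data.Empty using (⊥)
open import Data.Unit using (⊤)
open import Relation.Nullary using (¬_)
open import Relation.Unary using (Pred)
open import Relation.Binary using (Rel; IsEquivalence)
open import Relation.Binary.PropositionalEquality using (_≡_; refl)
open import Relation.Binary.Construct.Closure.Transitive using (TransClosure)

-- Words over agents: Ag* (no two equal adjacent letters), Ag^{≥n}

module _ {A : Set} where

  NoAdjRep : List A → Set
  NoAdjRep []           = ⊤
  NoAdjRep (x ∷ [])     = ⊤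
  NoAdjRep (x ∷ y ∷ w)  = ¬ (x ≡ y) × NoAdjRep (y ∷ w)

  AgWord≥ : ℕ → List A → Set
  AgWord≥ k w = NoAdjRep w × length w ≥ k

module _ (Prop : Set) (nAg : ℕ) where

  Ag : Set
  Ag = Fin nAg

  data Formula : Set where
    atom : Prop → Formula
    ⊥f   : Formula
    _⇒_  : Formula → Formula → Formula
    K    : Ag → Formula → Formula
    C    : Subset nAg → Formula → Formula
    X    : Formula → Formula

  record CGS : Set₁ where
    field
      nAc  : ℕ
      nV   : ℕ
    Ac : Set
    Ac = Fin nAc
    V : Set
    V = Fin nV
    JointAction : Set
    JointAction = Ag → Ac
    field
      E      : V → JointAction → V
      ℓ      : V → Pred Prop 0ℓ
      ∼V     : Ag → Rel V 0ℓ
      ∼Ac    : Ag → Rel Ac 0ℓ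
      ∼V-eq  : (a : Ag) → IsEquivalence (∼V a)
      ∼Ac-eq : (a : Ag) → IsEquivalence (∼Ac a)

  record InfoPersp : Set₁ where
    field
      mem : Pred (List Ag) 0ℓ
      ⊆Ag≥2 : ∀ w → mem w → AgWord≥ 2 w
  open InfoPersp public

  Iagents : InfoPersp → Ag → Pred Ag 0ℓ
  Iagents I a b = mem I (a ∷ b ∷ []) ⊎ b ≡ a

  Ibracket : InfoPersp → Ag → Pred (List Ag) 0ℓ
  Ibracket I a w =
    (AgWord≥ 2 w × mem I (a ∷ w)) ⊎
    (mem I w × ∃ λ w' → NoAdjRep w' × w ≡ a ∷ w')

  module Sem (𝒢 : CGS) where
    open CGS 𝒢

    data Hist : Set
    last : Hist → V

    data Hist where
      start : V → Hist
      snoc  : (ρ : Hist) (α : JointAction) (v : V) → .(E (last ρ) α ≡ v) → Hist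

    last (start v)        = v
    last (snoc _ _ v _)   = v

    Strategy : Set
    Strategy = Hist → Ac

    Assignment : Set
    Assignment = Ag → Strategy

    _∼J[_]_ : JointAction → Ag → JointAction → Set
    α ∼J[ a ] β = ∀ b → ∼Ac a (α b) (β b)

    _∼H[_]_ : Hist → Ag → Hist → Set
    start v        ∼H[ a ] start v'          = ∼V a v v'
    start _        ∼H[ a ] snoc _ _ _ _      = ⊥
    snoc _ _ _ _   ∼H[ a ] start _           = ⊥
    snoc ρ α v _   ∼H[ a ] snoc ρ' α' v' _   =
      (ρ ∼H[ a ] ρ') × (α ∼J[ a ] α') × ∼V a v v'

    Consistent : Hist → Assignment → Pred Ag 0ℓ → Set
    Consistent (start _)      χ Xs = ⊤
    Consistent (snoc ρ α _ _) χ Xs =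
      Consistent ρ χ Xs × (∀ b → Xs b → α b ≡ χ b ρ)

    next : Assignment → Hist → Hist
    next χ ρ = snoc ρ (λ b → χ b ρ) (E (last ρ) (λ b → χ b ρ)) refl

    record State : Set₁ where
      constructor ⟨_,_,_⟩
      field
        χ : Assignment
        I : InfoPersp
        ρ : Hist

    _∼S[_,_]_ : Assignment → InfoPersp → Ag → Assignment → Set
    χ ∼S[ I , a ] χ' = ∀ b → Iagents I a b → ∀ h → χ b h ≡ χ' b h

    aConsistent : Ag → State → Set
    aConsistent a ⟨ χ , I , ρ ⟩ = Consistent ρ χ (Iagents I a)

    _⊴[_]_ : State → Ag → State → Set
    Z@(⟨ χ , I , ρ ⟩) ⊴[ a ] Z'@(⟨ χ' , I' , ρ' ⟩) =
      χ ∼S[ I , a ] χ' ×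
      (∀ w → Ibracket I a w → mem I' w) ×
      ρ ∼H[ a ] ρ' ×
      aConsistent a Z × aConsistent a Z'

    _⊴G[_]_ : State → Subset nAg → State → Set
    Z ⊴G[ G ] Z' = ∃ λ a → a ∈ G × Z ⊴[ a ] Z'

    _⊴G*[_]_ : State → Subset nAg → State → Set₁
    Z ⊴G*[ G ] Z' = TransClosure (λ Y Y' → Y ⊴G[ G ] Y') Z Z'

    _⊩_ : State → Formula → Set₁
    Z ⊩ atom p  = Lift (lsuc 0ℓ) (ℓ (last (State.ρ Z)) p)
    Z ⊩ ⊥f      = Lift (lsuc 0ℓ) ⊥
    Z ⊩ (φ ⇒ ψ) = Z ⊩ φ → Z ⊩ ψ
    Z ⊩ K a φ   = ∀ Z' → Z ⊴[ a ] Z' → Z' ⊩ φ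
    Z ⊩ C G φ   = ∀ Z' → Z ⊴G*[ G ] Z' → Z' ⊩ φ
    ⟨ χ , I , ρ ⟩ ⊩ X φ = ⟨ χ , I , next χ ρ ⟩ ⊩ φ

  Valid : Formula → Set₁
  Valid φ = (𝒢 : CGS) (Z : Sem.State 𝒢) → Sem._⊩_ 𝒢 Z φ

{-# OPTIONS --safe #-}
-- Positive introspection holds because ⊴ₐ is transitive. For the perspective
-- components, the condition I[a] ⊆ I′ already yields I_a ⊆ I′_a (ab ∈ I is an
-- a-prefixed word of I) and I[a] ⊆ I′[a] (aw ∈ I is itself an a-prefixed word
-- of I), so I[a] ⊆ I′[a] ⊆ I″ and the agreement of strategies composes.
module Submission where

open import Defs
open import Data.Nat using (ℕ)
open import Data.List using ([]; _∷_)
open import Data.Product using (_,_; proj₁; proj₂)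
open import Data.Sum using (inj₁; inj₂)
open import Data.Unit using (tt)
open import Function.Bundles using (_↣_)
open import Relation.Binary using (IsEquivalence)
open import Relation.Binary.Definitions using (Transitive)
open import Relation.Binary.PropositionalEquality using (refl; trans)
open import Relation.Unary using (_⊆′_)

module _ {Prop : Set} {nAg : ℕ} {I I′ : InfoPersp Prop nAg} {a : Ag Prop nAg} where

  Iagents-mono : Ibracket Prop nAg I a ⊆′ mem I′ →
                 Iagents Prop nAg I a ⊆′ Iagents Prop nAg I′ a
  Iagents-mono I[a]⊆I′ b (inj₁ ab∈I) = inj₁ (I[a]⊆I′ _ (inj₂ (ab∈I , b ∷ [] , tt , refl)))
  Iagents-mono _       b (inj₂ b≡a)  = inj₂ b≡a

  Ibracket-mono : Ibracket Prop nAg I a ⊆′ mem I′ →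
                  Ibracket Prop nAg I a ⊆′ Ibracket Prop nAg I′ a
  Ibracket-mono I[a]⊆I′ w (inj₁ (w∈Ag≥2 , aw∈I)) =
    inj₁ (w∈Ag≥2 , I[a]⊆I′ _ (inj₂ (aw∈I , w , proj₁ w∈Ag≥2 , refl)))
  Ibracket-mono I[a]⊆I′ w (inj₂ w∈I[a]) =
    inj₂ (I[a]⊆I′ w (inj₂ w∈I[a]) , proj₂ w∈I[a])

module _ {Prop : Set} {nAg : ℕ} (𝒢 : CGS Prop nAg) where
  open CGS 𝒢
  open Sem Prop nAg 𝒢

  ∼J-trans : ∀ a → Transitive (_∼J[ a ]_)
  ∼J-trans a α∼β β∼γ b = IsEquivalence.trans (∼Ac-eq a) (α∼β b) (β∼γ b)

  ∼H-trans : ∀ a → Transitive (_∼H[ a ]_)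
  ∼H-trans a {start _} {start _} {start _} v∼v′ v′∼v″ = IsEquivalence.trans (∼V-eq a) v∼v′ v′∼v″
  ∼H-trans a {snoc ρ _ _ _} {snoc ρ′ _ _ _} {snoc ρ″ _ _ _}
    (ρ∼ρ′ , α∼α′ , v∼v′) (ρ′∼ρ″ , α′∼α″ , v′∼v″) =
    ∼H-trans a {ρ} {ρ′} {ρ″} ρ∼ρ′ ρ′∼ρ″ , ∼J-trans a α∼α′ α′∼α″ , IsEquivalence.trans (∼V-eq a) v∼v′ v′∼v″

  ∼S-trans : ∀ {a χ χ′ χ″} {I I′ : InfoPersp Prop nAg} →
             Iagents Prop nAg I a ⊆′ Iagents Prop nAg I′ a →
             χ ∼S[ I , a ] χ′ → χ′ ∼S[ I′ , a ] χ″ → χ ∼S[ I , a ] χ″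
  ∼S-trans Ia⊆I′a χ∼χ′ χ′∼χ″ b b∈Ia h = trans (χ∼χ′ b b∈Ia h) (χ′∼χ″ b (Ia⊆I′a b b∈Ia) h)

  ⊴-trans : ∀ a → Transitive (_⊴[ a ]_)
  ⊴-trans a {⟨ _ , I , ρ ⟩} {⟨ _ , I′ , ρ′ ⟩} {⟨ _ , _ , ρ″ ⟩}
    (χ∼χ′ , I[a]⊆I′ , ρ∼ρ′ , Z-cons , _) (χ′∼χ″ , I′[a]⊆I″ , ρ′∼ρ″ , _ , Z″-cons) =
    ∼S-trans {I = I} {I′} (Iagents-mono {I = I} {I′} I[a]⊆I′) χ∼χ′ χ′∼χ″ ,
    (λ w w∈I[a] → I′[a]⊆I″ w (Ibracket-mono {I = I} {I′} I[a]⊆I′ w w∈I[a])) ,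
    ∼H-trans a {ρ} {ρ′} {ρ″} ρ∼ρ′ ρ′∼ρ″ ,
    Z-cons ,
    Z″-cons

lemma3 : (Prop : Set) → Prop ↣ ℕ → (nAg : ℕ) → (a : Ag Prop nAg) →
    (φ : Formula Prop nAg) →
    Valid Prop nAg (_⇒_ (K a φ) (K a (K a φ)))
lemma3 Prop _ nAg a φ 𝒢 Z Kφ Z′ Z⊴Z′ Z″ Z′⊴Z″ = Kφ Z″ (⊴-trans 𝒢 a {Z} {Z′} {Z″} Z⊴Z′ Z′⊴Z″)
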